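{- Let $n$ be a positive integer. If $p$ is a prime number with $p>n^2/4+1$, then there is no arithmetical structure on $K_n$ with $r_1=p$.
   Context: An arithmetical structure on the complete graph $K_n$ (with $n$ vertices) is a collection of positive integers $r_1,r_2,\dotsc,r_n$ with $\gcd(r_1,\dotsc,r_n)=1$ such that $r_j$ divides $\sum_{i=1}^n r_i$ for every $j$. The values are ordered so that $r_1\geq r_2\geq\dotsb\geq r_n$; thus $r_1$ is the largest value of the structure. -}

module Defs where

open import Data.Nat using (ℕ; zero; suc; _+_; _*_; _≤_; _<_; _≥_)
open import Data.Nat.Divisibility using (_∣_)
open import Data.Nat.GCD using (gcd)
open import Data.Fin using (Fin; zero; suc; toℕ)
open import Data.Product using (_×_)
open import Relation.Binary.PropositionalEquality using (_≡_)

sumFin : (n : ℕ) → (Fin n → ℕ) → ℕ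
sumFin zero    r = 0
sumFin (suc n) r = r zero + sumFin n (λ i → r (suc i))

gcdFin : (n : ℕ) → (Fin n → ℕ) → ℕ
gcdFin zero    r = 0
gcdFin (suc n) r = gcd (r zero) (gcdFin n (λ i → r (suc i)))

-- Values ordered non-increasingly: r_1 ≥ r_2 ≥ ... ≥ r_n
-- (index zero corresponds to r_1).
NonIncreasing : (n : ℕ) → (Fin n → ℕ) → Set
NonIncreasing n r = ∀ (i j : Fin n) → toℕ i ≤ toℕ j → r j ≤ r i

-- An arithmetical structure on the complete graph K_n, given as an
-- ordered tuple r_1 ≥ ... ≥ r_n of positive integers with gcd 1 such that
-- each r_j divides the total sum.
record ArithStructure (n : ℕ) : Set where
  field
    r         : Fin n → ℕ
    positive  : ∀ i → 1 ≤ r i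
    ordered   : NonIncreasing n r
    coprime   : gcdFin n r ≡ 1
    divides   : ∀ j → r j ∣ sumFin n r

{-# OPTIONS --safe #-}
-- Every entry is at most p, so the total is k·p with k ≤ n (for n ≥ p the bound
-- 4p ≤ n² + 4 is trivial, so assume n < p).  An entry different from p is
-- coprime to p, hence divides k.  If m entries equal p and the remaining
-- c = n − m entries sum to d·p, then k = m + d, and d ≥ 1 because the gcd is 1.
-- For d ≥ 2 the bound d·p ≤ c·k already forces 4p ≤ (m + c)² + 4.  For d = 1
-- the deficits k − rᵢ of the small entries add up to W = c·k − p.  A proper
-- divisor of k is at most k/2, so each nonzero deficit is at least k/2 and,
-- if W ≤ k − 2, at most one deficit is nonzero.  W = 0 would make p = c·k a
-- product of two numbers below p; a single deficit k − rᵢ makes rᵢ divide p,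
-- so rᵢ = 1 and W = k − 1.  Hence W ≥ k − 1, which again gives 4p ≤ (m + c)² + 4.
module Submission where

open import Data.Bool using (Bool; true; false; if_then_else_; T)
open import Data.Empty using (⊥-elim)
open import Data.Fin using (Fin; zero; suc; toℕ; fromℕ<)
open import Data.Fin.Properties using (toℕ-fromℕ<)
open import Data.List using (_∷_; [])
open import Data.Nat
open import Data.Nat.Coprimality using (coprime-divisor; prime⇒coprime)
  renaming (sym to coprime-sym)
open import Data.Nat.Divisibility
open import Data.Nat.GCD using (gcd-greatest)
open import Data.Nat.Primality
  using (Prime; prime⇒irreducible; prime⇒nonZero; ¬prime[1])
open import Data.Nat.Properties
open import Algebra.Properties.CommutativeSemigroup +-commutativeSemigroup
  using () renaming (interchange to +-interchange)
open import Data.Nat.Tactic.RingSolver using (solve)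
open import Data.Product using (∃-syntax; _×_; _,_; proj₁; proj₂)
open import Data.Sum using (_⊎_; inj₁; inj₂)
open import Data.Unit using (tt)
open import Function using (_∘_)
open import Relation.Binary.PropositionalEquality
open import Relation.Nullary using (¬_; yes; no)

open import Defs

sumFin-cong : ∀ n {f g : Fin n → ℕ} → (∀ i → f i ≡ g i) → sumFin n f ≡ sumFin n g
sumFin-cong zero    f≗g = refl
sumFin-cong (suc n) f≗g = cong₂ _+_ (f≗g zero) (sumFin-cong n (f≗g ∘ suc))

sumFin-mono-≤ : ∀ n {f g : Fin n → ℕ} → (∀ i → f i ≤ g i) → sumFin n f ≤ sumFin n g
sumFin-mono-≤ zero    f≤g = z≤n
sumFin-mono-≤ (suc n) f≤g = +-mono-≤ (f≤g zero) (sumFin-mono-≤ n (f≤g ∘ suc))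

sumFin-distrib-+ : ∀ n (f g : Fin n → ℕ) →
                   sumFin n (λ i → f i + g i) ≡ sumFin n f + sumFin n g
sumFin-distrib-+ zero    f g = refl
sumFin-distrib-+ (suc n) f g =
  trans (cong (f zero + g zero +_) (sumFin-distrib-+ n (f ∘ suc) (g ∘ suc)))
        (+-interchange (f zero) (g zero) _ _)

sumFin-distribʳ-* : ∀ n (f : Fin n → ℕ) a → sumFin n (λ i → f i * a) ≡ sumFin n f * a
sumFin-distribʳ-* zero    f a = refl
sumFin-distribʳ-* (suc n) f a =
  trans (cong (f zero * a +_) (sumFin-distribʳ-* n (f ∘ suc) a))
        (sym (*-distribʳ-+ a (f zero) _))

sumFin-const : ∀ n a → sumFin n (λ _ → a) ≡ n * a
sumFin-const zero    a = refl
sumFin-const (suc n) a = cong (a +_) (sumFin-const n a)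

≤-sumFin : ∀ n (f : Fin n → ℕ) i → f i ≤ sumFin n f
≤-sumFin (suc n) f zero    = m≤m+n (f zero) _
≤-sumFin (suc n) f (suc i) = ≤-trans (≤-sumFin n (f ∘ suc) i) (m≤n+m _ (f zero))

sumFin-partition : ∀ n (b : Fin n → Bool) (f : Fin n → ℕ) →
                   sumFin n f ≡ sumFin n (λ i → if b i then f i else 0)
                              + sumFin n (λ i → if b i then 0 else f i)
sumFin-partition n b f =
  trans (sumFin-cong n (λ i → split (b i) (f i))) (sumFin-distrib-+ n _ _)
  where
  split : ∀ b x → x ≡ (if b then x else 0) + (if b then 0 else x)
  split true  x = sym (+-identityʳ x)
  split false x = refl

sumFin-below-threshold : ∀ n {k} (w : Fin n → ℕ) → (∀ i → w i ≡ 0 ⊎ k ≤ 2 * w i) →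
                         sumFin n w < k →
                         sumFin n w ≡ 0 ⊎ ∃[ i ] (sumFin n w ≡ w i × k ≤ 2 * w i)
sumFin-below-threshold zero    w large W<k = inj₁ refl
sumFin-below-threshold (suc n) {k} w large W<k
  with large zero
     | sumFin-below-threshold n (w ∘ suc) (large ∘ suc) (≤-<-trans (m≤n+m _ (w zero)) W<k)
... | inj₁ w₀≡0 | inj₁ rest≡0 = inj₁ (cong₂ _+_ w₀≡0 rest≡0)
... | inj₁ w₀≡0 | inj₂ (j , rest≡wⱼ , bigⱼ) =
  inj₂ (suc j , trans (cong (_+ sumFin n (w ∘ suc)) w₀≡0) rest≡wⱼ , bigⱼ)
... | inj₂ big₀ | inj₁ rest≡0 =
  inj₂ (zero , trans (cong (w zero +_) rest≡0) (+-identityʳ _) , big₀)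
... | inj₂ big₀ | inj₂ (j , rest≡wⱼ , bigⱼ) = ⊥-elim (<⇒≱ W<k (*-cancelˡ-≤ 2 (begin
  2 * k                         ≡⟨ cong (k +_) (+-identityʳ k) ⟩
  k + k                         ≤⟨ +-mono-≤ big₀ bigⱼ ⟩
  2 * w zero + 2 * w (suc j)    ≡⟨ sym (*-distribˡ-+ 2 (w zero) _) ⟩
  2 * (w zero + w (suc j))      ≡⟨ cong (λ x → 2 * (w zero + x)) (sym rest≡wⱼ) ⟩
  2 * sumFin (suc n) w          ∎)))
  where open ≤-Reasoning

∣-gcdFin : ∀ n {a} (f : Fin n → ℕ) → (∀ i → a ∣ f i) → a ∣ gcdFin n f
∣-gcdFin zero    f a∣f = _ ∣0
∣-gcdFin (suc n) f a∣f = gcd-greatest (a∣f zero) (∣-gcdFin n (f ∘ suc) (a∣f ∘ suc))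

2*m≤n⇒n≤2*[n∸m] : ∀ {m n} → 2 * m ≤ n → n ≤ 2 * (n ∸ m)
2*m≤n⇒n≤2*[n∸m] {m} {n} 2m≤n = begin
  n                       ≡⟨ sym (m+[n∸m]≡n m≤n) ⟩
  m + (n ∸ m)             ≤⟨ +-monoˡ-≤ (n ∸ m) (m+n≤o⇒m≤o∸n m m+m≤n) ⟩
  (n ∸ m) + (n ∸ m)       ≡⟨ cong ((n ∸ m) +_) (sym (+-identityʳ (n ∸ m))) ⟩
  2 * (n ∸ m)             ∎
  where
  open ≤-Reasoning
  m+m≤n : m + m ≤ n
  m+m≤n = subst (_≤ n) (cong (m +_) (+-identityʳ m)) 2m≤n
  m≤n : m ≤ n
  m≤n = ≤-trans (m≤m+n m m) m+m≤n

m∣n⇒n∸m≡0⊎n≤2*[n∸m] : ∀ {m n} .{{_ : NonZero n}} → m ∣ n → n ∸ m ≡ 0 ⊎ n ≤ 2 * (n ∸ m)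
m∣n⇒n∸m≡0⊎n≤2*[n∸m] {m} {n} m∣n with m≤n⇒m<n∨m≡n (∣⇒≤ m∣n)
... | inj₂ refl = inj₁ (n∸n≡0 m)
... | inj₁ m<n  = inj₂ (2*m≤n⇒n≤2*[n∸m] {m} (begin
  2 * m              ≤⟨ *-monoˡ-≤ m (quotient>1 m∣n m<n) ⟩
  quotient m∣n * m   ≡⟨ sym (m∣n⇒n≡quotient*m m∣n) ⟩
  n                  ∎))
  where open ≤-Reasoning

prime⇒m*n≢p : ∀ {m n p} → Prime p → m < p → n < p → m * n ≢ p
prime⇒m*n≢p {m} {n} p-prime m<p n<p m*n≡p
  with prime⇒irreducible p-prime (divides n (trans (sym m*n≡p) (*-comm m n)))
... | inj₁ refl = <-irrefl (trans (sym (*-identityˡ n)) m*n≡p) n<p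
... | inj₂ m≡p  = <-irrefl m≡p m<p

m≤n⇒2*m*n≤m*m+n*n : ∀ {m n} → m ≤ n → 2 * m * n ≤ m * m + n * n
m≤n⇒2*m*n≤m*m+n*n {m} {n} m≤n with n ∸ m | m+[n∸m]≡n m≤n
... | x | refl = begin
  2 * m * (m + x)              ≤⟨ m≤m+n _ (x * x) ⟩
  2 * m * (m + x) + x * x      ≡⟨ solve (m ∷ x ∷ []) ⟩
  m * m + (m + x) * (m + x)    ∎
  where open ≤-Reasoning

2*m*n≤m*m+n*n : ∀ m n → 2 * m * n ≤ m * m + n * n
2*m*n≤m*m+n*n m n with ≤-total m n
... | inj₁ m≤n = m≤n⇒2*m*n≤m*m+n*n m≤n
... | inj₂ n≤m = begin
  2 * m * n        ≡⟨ solve (m ∷ n ∷ []) ⟩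
  2 * n * m        ≤⟨ m≤n⇒2*m*n≤m*m+n*n n≤m ⟩
  n * n + m * m    ≡⟨ +-comm (n * n) (m * m) ⟩
  m * m + n * n    ∎
  where open ≤-Reasoning

4*n≤n*n+4 : ∀ n → 4 * n ≤ n * n + 4
4*n≤n*n+4 n = begin
  4 * n            ≡⟨ solve (n ∷ []) ⟩
  2 * n * 2        ≤⟨ 2*m*n≤m*m+n*n n 2 ⟩
  n * n + 4        ∎
  where open ≤-Reasoning

2≤d⇒4*p≤[m+c]²+4 : ∀ {c m d p} → 2 ≤ d → c ≤ p → d * p ≤ c * (m + d) →
                   4 * p ≤ (m + c) * (m + c) + 4
2≤d⇒4*p≤[m+c]²+4 {c} {m} {d} {p} 2≤d c≤p dp≤c[m+d] with p ∸ c | m+[n∸m]≡n c≤p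
... | y | refl = begin
  4 * (c + y)                            ≡⟨ solve (c ∷ y ∷ []) ⟩
  2 * c * 2 + 2 * (2 * y)                ≤⟨ +-mono-≤ (2*m*n≤m*m+n*n c 2) (*-monoʳ-≤ 2 2y≤cm) ⟩
  c * c + 2 * 2 + 2 * (c * m)            ≤⟨ m≤m+n _ (m * m) ⟩
  c * c + 2 * 2 + 2 * (c * m) + m * m    ≡⟨ solve (c ∷ m ∷ []) ⟩
  (m + c) * (m + c) + 4                  ∎
  where
  open ≤-Reasoning
  2y≤cm : 2 * y ≤ c * m
  2y≤cm = ≤-trans (*-monoˡ-≤ y 2≤d) (+-cancelʳ-≤ (d * c) (d * y) (c * m) (begin
    d * y + d * c     ≡⟨ solve (d ∷ y ∷ c ∷ []) ⟩
    d * (c + y)       ≤⟨ dp≤c[m+d] ⟩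
    c * (m + d)       ≡⟨ solve (c ∷ m ∷ d ∷ []) ⟩
    c * m + d * c     ∎))

-- (m + c)² + 4 − 4 (c (m + 1) + 1 − (m + 1)) = (m − c + 2)² ≥ 0, here in the
-- form 2 c (m + 2) ≤ c² + (m + 2)².
p+[m+1]≤c*[m+1]+1⇒4*p≤[m+c]²+4 : ∀ {c m p} → p + (m + 1) ≤ c * (m + 1) + 1 →
                                 4 * p ≤ (m + c) * (m + c) + 4
p+[m+1]≤c*[m+1]+1⇒4*p≤[m+c]²+4 {c} {m} {p} h =
  +-cancelʳ-≤ (4 * (m + 1) + 2 * c * (m + 2)) (4 * p) _ (begin
    4 * p + (4 * (m + 1) + 2 * c * (m + 2))               ≡⟨ solve (c ∷ m ∷ p ∷ []) ⟩
    4 * (p + (m + 1)) + 2 * c * (m + 2)                   ≤⟨ +-monoˡ-≤ _ (*-monoʳ-≤ 4 h) ⟩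
    4 * (c * (m + 1) + 1) + 2 * c * (m + 2)               ≤⟨ +-monoʳ-≤ _ (2*m*n≤m*m+n*n c (m + 2)) ⟩
    4 * (c * (m + 1) + 1) + (c * c + (m + 2) * (m + 2))   ≡⟨ solve (c ∷ m ∷ []) ⟩
    (m + c) * (m + c) + 4 + (4 * (m + 1) + 2 * c * (m + 2)) ∎)
  where open ≤-Reasoning

module LargestEntry {n} (A : ArithStructure n) (0<n : 0 < n) {p} (p-prime : Prime p)
                    (r₁≡p : ArithStructure.r A (fromℕ< 0<n) ≡ p) (n<p : n < p) where

  open ArithStructure A renaming (divides to r∣sum)

  instance
    p≢0 : NonZero p
    p≢0 = prime⇒nonZero p-prime

  r≤p : ∀ i → r i ≤ p
  r≤p i = subst (r i ≤_) r₁≡p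
    (ordered (fromℕ< 0<n) i (subst (_≤ toℕ i) (sym (toℕ-fromℕ< 0<n)) z≤n))

  isP : Fin n → Bool
  isP i = r i ≡ᵇ p

  isP⇒≡ : ∀ {i} → isP i ≡ true → r i ≡ p
  isP⇒≡ {i} eq = ≡ᵇ⇒≡ (r i) p (subst T (sym eq) tt)

  isP⇒≢ : ∀ {i} → isP i ≡ false → r i ≢ p
  isP⇒≢ {i} eq r≡p = subst T eq (≡⇒≡ᵇ (r i) p r≡p)

  m c s : ℕ
  m = sumFin n (λ i → if isP i then 1 else 0)
  c = sumFin n (λ i → if isP i then 0 else 1)
  s = sumFin n (λ i → if isP i then 0 else r i)

  n≡m+c : n ≡ m + c
  n≡m+c = trans (sym (trans (sumFin-const n 1) (*-identityʳ n)))
                (sumFin-partition n isP (λ _ → 1))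

  sum≡m*p+s : sumFin n r ≡ m * p + s
  sum≡m*p+s = begin
    sumFin n r                                          ≡⟨ sumFin-partition n isP r ⟩
    sumFin n (λ i → if isP i then r i else 0) + s       ≡⟨ cong (_+ s) (sumFin-cong n top) ⟩
    sumFin n (λ i → (if isP i then 1 else 0) * p) + s   ≡⟨ cong (_+ s) (sumFin-distribʳ-* n _ p) ⟩
    m * p + s                                           ∎
    where
    open ≡-Reasoning
    top : ∀ i → (if isP i then r i else 0) ≡ (if isP i then 1 else 0) * p
    top i with isP i in eq
    ... | true  = trans (isP⇒≡ eq) (sym (*-identityˡ p))
    ... | false = refl

  p∣sum : p ∣ sumFin n r
  p∣sum = subst (_∣ sumFin n r) r₁≡p (r∣sum (fromℕ< 0<n))

  k : ℕ
  k = quotient p∣sum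

  sum≡k*p : sumFin n r ≡ k * p
  sum≡k*p = m∣n⇒n≡quotient*m p∣sum

  p∣s : p ∣ s
  p∣s = ∣m+n∣m⇒∣n (subst (p ∣_) sum≡m*p+s p∣sum) (n∣m*n m)

  d : ℕ
  d = quotient p∣s

  s≡d*p : s ≡ d * p
  s≡d*p = m∣n⇒n≡quotient*m p∣s

  k≡m+d : k ≡ m + d
  k≡m+d = *-cancelʳ-≡ k (m + d) p (begin
    k * p            ≡⟨ sym sum≡k*p ⟩
    sumFin n r       ≡⟨ sum≡m*p+s ⟩
    m * p + s        ≡⟨ cong (m * p +_) s≡d*p ⟩
    m * p + d * p    ≡⟨ sym (*-distribʳ-+ p m d) ⟩
    (m + d) * p      ∎)
    where open ≡-Reasoning

  k<p : k < p
  k<p = ≤-<-trans (*-cancelʳ-≤ k n p (begin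
    k * p                ≡⟨ sym sum≡k*p ⟩
    sumFin n r           ≤⟨ sumFin-mono-≤ n r≤p ⟩
    sumFin n (λ _ → p)   ≡⟨ sumFin-const n p ⟩
    n * p                ∎)) n<p
    where open ≤-Reasoning

  c<p : c < p
  c<p = ≤-<-trans (subst (c ≤_) (sym n≡m+c) (m≤n+m c m)) n<p

  s≢0 : s ≢ 0
  s≢0 s≡0 = ¬prime[1] (subst Prime (∣1⇒≡1 (subst (p ∣_) coprime p∣gcd)) p-prime)
    where
    all≡p : ∀ i → r i ≡ p
    all≡p i with isP i in eq | ≤-sumFin n (λ i → if isP i then 0 else r i) i
    ... | true  | _        = isP⇒≡ eq
    ... | false | rᵢ≤s = ⊥-elim (<⇒≱ (positive i) (subst (r i ≤_) s≡0 rᵢ≤s))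
    p∣gcd : p ∣ gcdFin n r
    p∣gcd = ∣-gcdFin n r (λ i → ∣-reflexive (sym (all≡p i)))

  0<d : 0 < d
  0<d = n≢0⇒n>0 (λ d≡0 → s≢0 (trans s≡d*p (cong (_* p) d≡0)))

  instance
    k≢0 : NonZero k
    k≢0 = >-nonZero (≤-trans 0<d (subst (d ≤_) (sym k≡m+d) (m≤n+m d m)))

  r∣k : ∀ i → r i ≢ p → r i ∣ k
  r∣k i rᵢ≢p = coprime-divisor
    (coprime-sym (prime⇒coprime p-prime {{>-nonZero (positive i)}} (≤∧≢⇒< (r≤p i) rᵢ≢p)))
    (subst (r i ∣_) (trans sum≡k*p (*-comm k p)) (r∣sum i))

  w : Fin n → ℕ
  w i = if isP i then 0 else k ∸ r i

  W : ℕ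
  W = sumFin n w

  c*k≡s+W : c * k ≡ s + W
  c*k≡s+W = begin
    c * k                                                ≡⟨ sym (sumFin-distribʳ-* n _ k) ⟩
    sumFin n (λ i → (if isP i then 0 else 1) * k)        ≡⟨ sumFin-cong n split ⟩
    sumFin n (λ i → (if isP i then 0 else r i) + w i)    ≡⟨ sumFin-distrib-+ n _ w ⟩
    s + W                                                ∎
    where
    open ≡-Reasoning
    split : ∀ i → (if isP i then 0 else 1) * k ≡ (if isP i then 0 else r i) + w i
    split i with isP i in eq
    ... | true  = refl
    ... | false = trans (*-identityˡ k) (sym (m+[n∸m]≡n (∣⇒≤ (r∣k i (isP⇒≢ eq)))))

  w≡0⊎k≤2*w : ∀ i → w i ≡ 0 ⊎ k ≤ 2 * w i
  w≡0⊎k≤2*w i with isP i in eq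
  ... | true  = inj₁ refl
  ... | false = m∣n⇒n∸m≡0⊎n≤2*[n∸m] (r∣k i (isP⇒≢ eq))

  w≢0⇒r≢p×w≡k∸r : ∀ i → w i ≢ 0 → r i ≢ p × w i ≡ k ∸ r i
  w≢0⇒r≢p×w≡k∸r i wᵢ≢0 with isP i in eq
  ... | true  = ⊥-elim (wᵢ≢0 refl)
  ... | false = isP⇒≢ eq , refl

  single-deficit⇒W+1≡k : ∀ i → c * k ≡ p + W → W ≡ w i → w i ≢ 0 → W + 1 ≡ k
  single-deficit⇒W+1≡k i c*k≡p+W W≡wᵢ wᵢ≢0 = begin
    W + 1          ≡⟨ cong (_+ 1) W≡k∸rᵢ ⟩
    k ∸ r i + 1    ≡⟨ cong (λ x → k ∸ x + 1) rᵢ≡1 ⟩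
    k ∸ 1 + 1      ≡⟨ m∸n+n≡m (>-nonZero⁻¹ k) ⟩
    k              ∎
    where
    open ≡-Reasoning
    rᵢ≢p : r i ≢ p
    rᵢ≢p = proj₁ (w≢0⇒r≢p×w≡k∸r i wᵢ≢0)
    W≡k∸rᵢ : W ≡ k ∸ r i
    W≡k∸rᵢ = trans W≡wᵢ (proj₂ (w≢0⇒r≢p×w≡k∸r i wᵢ≢0))
    rᵢ∣k : r i ∣ k
    rᵢ∣k = r∣k i rᵢ≢p
    rᵢ∣W : r i ∣ W
    rᵢ∣W = subst (r i ∣_) (sym W≡k∸rᵢ)
      (∣m+n∣m⇒∣n (subst (r i ∣_) (sym (m+[n∸m]≡n (∣⇒≤ rᵢ∣k))) rᵢ∣k) ∣-refl)
    rᵢ∣p : r i ∣ p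
    rᵢ∣p = ∣m+n∣m⇒∣n (subst (r i ∣_) (trans c*k≡p+W (+-comm p W)) (∣n⇒∣m*n c rᵢ∣k)) rᵢ∣W
    rᵢ≡1 : r i ≡ 1
    rᵢ≡1 with prime⇒irreducible p-prime rᵢ∣p
    ... | inj₁ rᵢ≡1 = rᵢ≡1
    ... | inj₂ rᵢ≡p = ⊥-elim (rᵢ≢p rᵢ≡p)

  k≤W+1 : c * k ≡ p + W → k ≤ W + 1
  k≤W+1 c*k≡p+W with k ≤? W + 1
  ... | yes le = le
  ... | no k≰W+1 with sumFin-below-threshold n w w≡0⊎k≤2*w (≤-<-trans (m≤m+n W 1) (≰⇒> k≰W+1))
  ...   | inj₁ W≡0 = ⊥-elim (prime⇒m*n≢p p-prime c<p k<p
                       (trans c*k≡p+W (trans (cong (p +_) W≡0) (+-identityʳ p))))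
  ...   | inj₂ (i , W≡wᵢ , k≤2*wᵢ) = ⊥-elim (<-irrefl
                       (single-deficit⇒W+1≡k i c*k≡p+W W≡wᵢ wᵢ≢0) (≰⇒> k≰W+1))
    where
    wᵢ≢0 : w i ≢ 0
    wᵢ≢0 wᵢ≡0 = <⇒≱ (>-nonZero⁻¹ k) (subst (λ x → k ≤ 2 * x) wᵢ≡0 k≤2*wᵢ)

  2≤d⇒bound : 2 ≤ d → 4 * p ≤ n * n + 4
  2≤d⇒bound 2≤d = subst (λ x → 4 * p ≤ x * x + 4) (sym n≡m+c)
    (2≤d⇒4*p≤[m+c]²+4 2≤d (<⇒≤ c<p) (begin
      d * p         ≡⟨ sym s≡d*p ⟩
      s             ≤⟨ m≤m+n s W ⟩
      s + W         ≡⟨ sym c*k≡s+W ⟩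
      c * k         ≡⟨ cong (c *_) k≡m+d ⟩
      c * (m + d)   ∎))
    where open ≤-Reasoning

  d≡1⇒bound : d ≡ 1 → 4 * p ≤ n * n + 4
  d≡1⇒bound d≡1 = subst (λ x → 4 * p ≤ x * x + 4) (sym n≡m+c)
    (p+[m+1]≤c*[m+1]+1⇒4*p≤[m+c]²+4 {c} {m} {p} (begin
      p + (m + 1)       ≡⟨ cong (p +_) (sym k≡m+1) ⟩
      p + k             ≤⟨ +-monoʳ-≤ p (k≤W+1 c*k≡p+W) ⟩
      p + (W + 1)       ≡⟨ sym (+-assoc p W 1) ⟩
      p + W + 1         ≡⟨ cong (_+ 1) (sym c*k≡p+W) ⟩
      c * k + 1         ≡⟨ cong (λ x → c * x + 1) k≡m+1 ⟩
      c * (m + 1) + 1   ∎))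
    where
    open ≤-Reasoning
    k≡m+1 : k ≡ m + 1
    k≡m+1 = trans k≡m+d (cong (m +_) d≡1)
    c*k≡p+W : c * k ≡ p + W
    c*k≡p+W = trans c*k≡s+W (cong (_+ W) (trans s≡d*p (trans (cong (_* p) d≡1) (*-identityˡ p))))

  bound : 4 * p ≤ n * n + 4
  bound with m≤n⇒m<n∨m≡n 0<d
  ... | inj₁ 2≤d = 2≤d⇒bound 2≤d
  ... | inj₂ 1≡d = d≡1⇒bound (sym 1≡d)

prime-largest-entry⇒4*p≤n*n+4 : ∀ {n p} (A : ArithStructure n) (0<n : 0 < n) → Prime p →
                                ArithStructure.r A (fromℕ< 0<n) ≡ p → 4 * p ≤ n * n + 4
prime-largest-entry⇒4*p≤n*n+4 {n} {p} A 0<n p-prime r₁≡p with n <? p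
... | yes n<p = LargestEntry.bound A 0<n p-prime r₁≡p n<p
... | no  n≮p = ≤-trans (*-monoʳ-≤ 4 (≮⇒≥ n≮p)) (4*n≤n*n+4 n)

theorem3p2 : (n : ℕ) → (0<n : 0 < n) → (p : ℕ) → Prime p → n * n + 4 < 4 * p →
    (A : ArithStructure n) → ¬ (ArithStructure.r A (fromℕ< 0<n) ≡ p)
theorem3p2 n 0<n p p-prime n²+4<4p A r₁≡p =
  <⇒≱ n²+4<4p (prime-largest-entry⇒4*p≤n*n+4 A 0<n p-prime r₁≡p)
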